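{- Let $(\mathscr A,\preceq,\multimap,!)$ be an exponential implicative structure. Define $a\to b := {!a}\multimap b$. Then $(\mathscr A,\preceq,\to)$ is an implicative structure. Moreover, if $S\subseteq\mathscr A$ is an exponential separator of $(\mathscr A,\preceq,\multimap,!)$, then $S$ is an intuitionistic separator of $(\mathscr A,\preceq,\to)$: it is upward closed, closed under modus ponens for $\to$ (i.e. $a\in S$ and $({!a}\multimap b)\in S$ imply $b\in S$), and contains $\mathbf K'=\bigwedge_{a,b}({!a}\multimap{!b}\multimap a)$ and $\mathbf S'=\bigwedge_{a,b,c}({!({!a}\multimap{!b}\multimap c)}\multimap{!({!a}\multimap b)}\multimap{!a}\multimap c)$.
   Context: An implicative structure $(\mathscr A,\preceq,\multimap)$ is a complete lattice with a binary operation $\multimap$ such that $a'\preceq a$, $b\preceq b'$ imply $(a\multimap b)\preceq(a'\multimap b')$, and $a\multimap\bigwedge_{b\in B}b=\bigwedge_{b\in B}(a\multimap b)$ for all $B\subseteq\mathscr A$; $\multimap$ associates to the right. An exponential implicative structure is an implicative structure together with a monotone map $!:\mathscr A\to\mathscr A$. A linear separator is a subset $S$ that is upward closed, closed under modus ponens ($a\in S$, $(a\multimap b)\in S$ imply $b\in S$), and contains $\bigwedge_a(a\multimap a)$, $\bigwedge_{a,b,c}((b\multimap c)\multimap(a\multimap b)\multimap a\multimap c)$ and $\bigwedge_{a,b,c}((a\multimap b\multimap c)\multimap b\multimap a\multimap c)$. An exponential separator is a linear separator $S$ closed under $!$ ($a\in S\Rightarrow {!a}\in S$) and containing $\mathbf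 K_!=\bigwedge_{a,b}(a\multimap{!b}\multimap a)$, $\mathbf W_!=\bigwedge_{a,b}(({!a}\multimap{!a}\multimap b)\multimap{!a}\multimap b)$, $\mathbf F=\bigwedge_{a,b}({!(a\multimap b)}\multimap{!a}\multimap{!b})$, $\mathbf D=\bigwedge_a({!a}\multimap a)$ and $\delta=\bigwedge_a({!a}\multimap{!!a})$. -}

module Defs where

open import Level using (Level; suc; _⊔_)
open import Data.Product using (Σ; _×_; _,_)
open import Relation.Binary.PropositionalEquality using (_≡_)

-- Subsets of A are predicates A → Set ℓ; the meet of a subset B is the meet
-- of the family  proj₁ : Σ A B → A.
record CompleteLattice (ℓ : Level) : Set (suc ℓ) where
  field
    Carrier   : Set ℓ
    _≼_       : Carrier → Carrier → Set ℓ
    ≼-refl    : ∀ {a} → a ≼ a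
    ≼-trans   : ∀ {a b c} → a ≼ b → b ≼ c → a ≼ c
    ≼-antisym : ∀ {a b} → a ≼ b → b ≼ a → a ≡ b
    ⋀         : {I : Set ℓ} → (I → Carrier) → Carrier
    ⋀-lower   : {I : Set ℓ} (f : I → Carrier) (i : I) → ⋀ f ≼ f i
    ⋀-greatest : {I : Set ℓ} (f : I → Carrier) (c : Carrier) →
                 (∀ i → c ≼ f i) → c ≼ ⋀ f

module _ {ℓ : Level} (L : CompleteLattice ℓ) where
  open CompleteLattice L

  record IsImplicative (_⊸_ : Carrier → Carrier → Carrier) : Set (suc ℓ) where
    field
      ⊸-mono : ∀ {a a′ b b′} → a′ ≼ a → b ≼ b′ → (a ⊸ b) ≼ (a′ ⊸ b′)
      ⊸-⋀    : (a : Carrier) (B : Carrier → Set ℓ) →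
               (a ⊸ ⋀ {Σ Carrier B} (λ { (b , _) → b }))
                 ≡ ⋀ {Σ Carrier B} (λ { (b , _) → a ⊸ b })

record ExpImplicativeStructure (ℓ : Level) : Set (suc ℓ) where
  field
    lattice : CompleteLattice ℓ
  open CompleteLattice lattice public
  infixr 5 _⊸_
  field
    _⊸_          : Carrier → Carrier → Carrier
    isImplicative : IsImplicative lattice _⊸_
    !            : Carrier → Carrier
    !-mono       : ∀ {a b} → a ≼ b → ! a ≼ ! b

  _⇒_ : Carrier → Carrier → Carrier
  a ⇒ b = ! a ⊸ b

  ⋀₁ : (Carrier → Carrier) → Carrier
  ⋀₁ f = ⋀ f
  ⋀₂ : (Carrier → Carrier → Carrier) → Carrier
  ⋀₂ f = ⋀ {Carrier × Carrier} (λ { (a , b) → f a b })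
  ⋀₃ : (Carrier → Carrier → Carrier → Carrier) → Carrier
  ⋀₃ f = ⋀ {Carrier × Carrier × Carrier} (λ { (a , b , c) → f a b c })

  Iₗ Bₗ Cₗ : Carrier
  Iₗ = ⋀₁ (λ a → a ⊸ a)
  Bₗ = ⋀₃ (λ a b c → (b ⊸ c) ⊸ (a ⊸ b) ⊸ a ⊸ c)
  Cₗ = ⋀₃ (λ a b c → (a ⊸ b ⊸ c) ⊸ b ⊸ a ⊸ c)

  K! W! F D δ : Carrier
  K! = ⋀₂ (λ a b → a ⊸ ! b ⊸ a)
  W! = ⋀₂ (λ a b → (! a ⊸ ! a ⊸ b) ⊸ ! a ⊸ b)
  F  = ⋀₂ (λ a b → ! (a ⊸ b) ⊸ ! a ⊸ ! b)
  D  = ⋀₁ (λ a → ! a ⊸ a)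
  δ  = ⋀₁ (λ a → ! a ⊸ ! (! a))

  K′ S′ : Carrier
  K′ = ⋀₂ (λ a b → ! a ⊸ ! b ⊸ a)
  S′ = ⋀₃ (λ a b c → ! (! a ⊸ ! b ⊸ c) ⊸ ! (! a ⊸ b) ⊸ ! a ⊸ c)

  record IsLinearSeparator (S : Carrier → Set ℓ) : Set ℓ where
    field
      upward : ∀ {a b} → S a → a ≼ b → S b
      mp     : ∀ {a b} → S a → S (a ⊸ b) → S b
      I∈     : S Iₗ
      B∈     : S Bₗ
      C∈     : S Cₗ

  record IsExpSeparator (S : Carrier → Set ℓ) : Set ℓ where
    field
      linear : IsLinearSeparator S
      !-clos : ∀ {a} → S a → S (! a)
      K!∈    : S K!
      W!∈    : S W!
      F∈     : S F
      D∈     : S D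
      δ∈     : S δ

  record IsIntSeparator⇒ (S : Carrier → Set ℓ) : Set ℓ where
    field
      upward : ∀ {a b} → S a → a ≼ b → S b
      mp     : ∀ {a b} → S a → S (a ⇒ b) → S b
      K′∈    : S K′
      S′∈    : S S′

-- Read !a ⊸ b as an intuitionistic implication: the exponential rules K!, W!
-- let a banged hypothesis be discarded and duplicated, and F, D, δ make ! a
-- comonad, so K′ and S′ are realized by combinations of the linear
-- combinators B, C with these. Membership of a meet in S needs a single
-- realizer below every instance, so the derivations are carried out for
-- families of formulas, with realizers combined by the application
-- a · b = ⋀ {c ∣ a ≼ b ⊸ c} of the implicative structure.
module Submission where

open import Defs
open import Level using (Level)
open import Data.Product using (_×_; Σ; _,_; proj₁; proj₂)
open import Relation.Binary.PropositionalEquality using (_≡_; refl; sym; subst)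

module Implicative {ℓ : Level} (L : CompleteLattice ℓ)
                   {_⊸_ : CompleteLattice.Carrier L → CompleteLattice.Carrier L →
                          CompleteLattice.Carrier L}
                   (imp : IsImplicative L _⊸_) where
  open CompleteLattice L
  open IsImplicative imp

  -- ⊸-⋀ is stated for subsets; a family is reduced to its image.
  ⊸-⋀-greatest : {I : Set ℓ} (f : I → Carrier) (a c : Carrier) →
                 (∀ i → c ≼ (a ⊸ f i)) → c ≼ (a ⊸ ⋀ f)
  ⊸-⋀-greatest {I} f a c c≼a⊸f =
    ≼-trans (subst (c ≼_) (sym (⊸-⋀ a Image)) (⋀-greatest _ c c≼a⊸image))
            (⊸-mono ≼-refl (⋀-greatest f _ (λ i → ⋀-lower _ (f i , i , refl))))
    where
    Image : Carrier → Set ℓ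
    Image x = Σ I (λ i → f i ≡ x)
    c≼a⊸image : (x : Σ Carrier Image) → c ≼ (a ⊸ proj₁ x)
    c≼a⊸image (.(f i) , i , refl) = c≼a⊸f i

  infixl 25 _·_
  _·_ : Carrier → Carrier → Carrier
  a · b = ⋀ {Σ Carrier (λ c → a ≼ (b ⊸ c))} proj₁

  ≼⊸· : ∀ a b → a ≼ (b ⊸ a · b)
  ≼⊸· a b = ⊸-⋀-greatest proj₁ b a proj₂

  ·-≼ : ∀ {a b p q} → a ≼ (p ⊸ q) → b ≼ p → a · b ≼ q
  ·-≼ a≼p⊸q b≼p = ⋀-lower proj₁ (_ , ≼-trans a≼p⊸q (⊸-mono b≼p ≼-refl))

  precompose-isImplicative : (g : Carrier → Carrier) →
                             (∀ {a b} → a ≼ b → g a ≼ g b) →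
                             IsImplicative L (λ a b → g a ⊸ b)
  precompose-isImplicative g g-mono = record
    { ⊸-mono = λ a′≼a b≼b′ → ⊸-mono (g-mono a′≼a) b≼b′
    ; ⊸-⋀    = λ a → ⊸-⋀ (g a)
    }

module Separator {ℓ : Level} (E : ExpImplicativeStructure ℓ)
                 (S : ExpImplicativeStructure.Carrier E → Set ℓ)
                 (isExpSeparator : ExpImplicativeStructure.IsExpSeparator E S) where
  open ExpImplicativeStructure E
  open Implicative lattice isImplicative
  open IsExpSeparator isExpSeparator
  open IsLinearSeparator linear

  ·-closed : ∀ {a b} → S a → S b → S (a · b)
  ·-closed {a} {b} a∈S b∈S = mp b∈S (upward a∈S (≼⊸· a b))

  ⊩_ : {I : Set ℓ} → (I → Carrier) → Set ℓ
  ⊩_ {I} t = Σ Carrier (λ e → S e × (∀ i → e ≼ t i))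

  ⊩⇒⋀∈ : {I : Set ℓ} {t : I → Carrier} → ⊩ t → S (⋀ t)
  ⊩⇒⋀∈ {t = t} (e , e∈S , e≼t) = upward e∈S (⋀-greatest t e e≼t)

  ⊩-instance : {I J : Set ℓ} {g : J → Carrier} → S (⋀ g) → (σ : I → J) →
               ⊩ (λ i → g (σ i))
  ⊩-instance {g = g} ⋀g∈S σ = ⋀ g , ⋀g∈S , (λ i → ⋀-lower g (σ i))

  ⊩-mp : {I : Set ℓ} {p q : I → Carrier} →
         ⊩ (λ i → p i ⊸ q i) → ⊩ p → ⊩ q
  ⊩-mp (e , e∈S , e≼p⊸q) (f , f∈S , f≼p) =
    e · f , ·-closed e∈S f∈S , (λ i → ·-≼ (e≼p⊸q i) (f≼p i))

  module _ {I : Set ℓ} {p q r : I → Carrier} where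
    ⊩-B : ⊩ (λ i → (q i ⊸ r i) ⊸ (p i ⊸ q i) ⊸ p i ⊸ r i)
    ⊩-B = ⊩-instance B∈ (λ i → p i , q i , r i)

    ⊩-C : ⊩ (λ i → (p i ⊸ q i ⊸ r i) ⊸ q i ⊸ p i ⊸ r i)
    ⊩-C = ⊩-instance C∈ (λ i → p i , q i , r i)

  module _ {I : Set ℓ} {p q r : I → Carrier} where
    ⊩-∘ : ⊩ (λ i → q i ⊸ r i) → ⊩ (λ i → p i ⊸ q i) → ⊩ (λ i → p i ⊸ r i)
    ⊩-∘ g f = ⊩-mp (⊩-mp ⊩-B g) f

    ⊩-postcompose : ⊩ (λ i → q i ⊸ r i) →
                    ⊩ (λ i → (p i ⊸ q i) ⊸ p i ⊸ r i)
    ⊩-postcompose = ⊩-mp ⊩-B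

    ⊩-swap : ⊩ (λ i → p i ⊸ q i ⊸ r i) → ⊩ (λ i → q i ⊸ p i ⊸ r i)
    ⊩-swap = ⊩-mp ⊩-C

    ⊩-precompose : ⊩ (λ i → p i ⊸ q i) →
                   ⊩ (λ i → (q i ⊸ r i) ⊸ p i ⊸ r i)
    ⊩-precompose = ⊩-mp (⊩-mp ⊩-C ⊩-B)

  module _ {I : Set ℓ} {a b : I → Carrier} where
    ⊩-K! : ⊩ (λ i → a i ⊸ ! (b i) ⊸ a i)
    ⊩-K! = ⊩-instance K!∈ (λ i → a i , b i)

    ⊩-W! : ⊩ (λ i → (! (a i) ⊸ ! (a i) ⊸ b i) ⊸ ! (a i) ⊸ b i)
    ⊩-W! = ⊩-instance W!∈ (λ i → a i , b i)

    ⊩-F : ⊩ (λ i → ! (a i ⊸ b i) ⊸ ! (a i) ⊸ ! (b i))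
    ⊩-F = ⊩-instance F∈ (λ i → a i , b i)

  module _ {I : Set ℓ} {a : I → Carrier} where
    ⊩-D : ⊩ (λ i → ! (a i) ⊸ a i)
    ⊩-D = ⊩-instance D∈ a

    ⊩-δ : ⊩ (λ i → ! (a i) ⊸ ! (! (a i)))
    ⊩-δ = ⊩-instance δ∈ a

  K′∈ : S K′
  K′∈ = ⊩⇒⋀∈ (⊩-∘ ⊩-K! ⊩-D)

  module _ {I : Set ℓ} {a b c : I → Carrier} where
    ⊩-F⇒ : ⊩ (λ i → ! (! (a i) ⊸ b i) ⊸ ! (a i) ⊸ ! (b i))
    ⊩-F⇒ = ⊩-∘ (⊩-precompose ⊩-δ) ⊩-F

    ⊩-S′ : ⊩ (λ i → ! (! (a i) ⊸ ! (b i) ⊸ c i) ⊸ ! (! (a i) ⊸ b i) ⊸ ! (a i) ⊸ c i)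
    ⊩-S′ = ⊩-∘ (⊩-postcompose ⊩-W!) (⊩-∘ ⊩-C (⊩-∘ (⊩-postcompose feed) ⊩-D))
      where
      feed : ⊩ (λ i → (! (b i) ⊸ c i) ⊸ ! (! (a i) ⊸ b i) ⊸ ! (a i) ⊸ c i)
      feed = ⊩-swap (⊩-∘ (⊩-swap ⊩-B) ⊩-F⇒)

  S′∈ : S S′
  S′∈ = ⊩⇒⋀∈ ⊩-S′

  isIntSeparator⇒ : IsIntSeparator⇒ S
  isIntSeparator⇒ = record
    { upward = upward
    ; mp     = λ a∈S !a⊸b∈S → mp (!-clos a∈S) !a⊸b∈S
    ; K′∈    = K′∈
    ; S′∈    = S′∈
    }

theorem4p1 : {ℓ : Level} (E : ExpImplicativeStructure ℓ) →
    let open ExpImplicativeStructure E in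
    IsImplicative lattice _⇒_ ×
    ((S : Carrier → Set ℓ) → IsExpSeparator S → IsIntSeparator⇒ S)
theorem4p1 E =
  precompose-isImplicative ! !-mono , Separator.isIntSeparator⇒ E
  where
  open ExpImplicativeStructure E
  open Implicative lattice isImplicative
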